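{- Every formula $\phi\in\mathcal{L}'$ is bi-persistent in $\mathbf{MP}^*$, i.e. $\vdash_{\mathbf{MP}^*}(\phi\to\Box\phi)\land(\neg\phi\to\Box\neg\phi)$.
   Context: Formulas: built from a countable set $\mathsf{A}$ of atomic formulas (containing $\top,\bot$) by $\land,\neg,\Box,\mathsf{K}$; $\Diamond\phi:=\neg\Box\neg\phi$, $\mathsf{L}\phi:=\neg\mathsf{K}\neg\phi$. $\mathcal{L}'$ is the least set of formulas containing $\mathsf{A}$ and closed under $\land$, $\neg$, and $\phi\mapsto\Diamond\mathsf{K}\phi$. The system $\mathbf{MP}^*$ has rules modus ponens, $\mathsf{K}$-necessitation ($\phi/\mathsf{K}\phi$), $\Box$-necessitation ($\phi/\Box\phi$) and axioms all instances of: (1) propositional tautologies; (2) $(A\to\Box A)\land(\neg A\to\Box\neg A)$ for atomic $A$; (3) $\Box(\phi\to\psi)\to(\Box\phi\to\Box\psi)$; (4) $\Box\phi\to\phi$; (5) $\Box\phi\to\Box\Box\phi$; (6) $\mathsf{K}(\phi\to\psi)\to(\mathsf{K}\phi\to\mathsf{K}\psi)$; (7) $\mathsf{K}\phi\to\phi$; (8) $\mathsf{K}\phi\to\mathsf{K}\mathsf{K}\phi$; (9) $\phi\to\mathsf{K}\mathsf{L}\phi$; (10) $\mathsf{K}\Box\phi\to\Box\mathsf{K}\phi$; (11) $\Diamond\Box\phi\to\Box\Diamond\phi$; (12) $\Diamond(\mathsf{K}\phi\land\psi)\land\mathsf{L}\Diamond(\mathsf{K}\phi\land\chi)\to\Diamond(\mathsf{K}\Diamond\phi\land\Diamond\psi\land\mathsf{L}\Diamond\chi)$.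 -}

module Defs where

open import Data.Nat using (ℕ)
open import Data.Bool using (Bool; true; false; _∧_; not)
open import Relation.Binary.PropositionalEquality using (_≡_)

data Atom : Set where
  ⊤ₐ : Atom
  ⊥ₐ : Atom
  var : ℕ → Atom

data Formula : Set where
  atom : Atom → Formula
  _∧'_ : Formula → Formula → Formula
  ¬'_  : Formula → Formula
  □_   : Formula → Formula
  K_   : Formula → Formula

infixr 6 _∧'_
infix 8 ¬'_ □_ K_ ◇_ L_
infixr 4 _⇒_

⊤' ⊥' : Formula
⊤' = atom ⊤ₐ
⊥' = atom ⊥ₐ

_⇒_ : Formula → Formula → Formula
φ ⇒ ψ = ¬' (φ ∧' ¬' ψ)

◇_ : Formula → Formula
◇ φ = ¬' □ ¬' φ

L_ : Formula → Formula
L φ = ¬' K ¬' φ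

-- Propositional (truth-functional) evaluation: ∧ and ¬ are interpreted
-- classically, ⊤ is true, ⊥ is false, and every other formula
-- (propositional variables, □ψ, Kψ) is treated as a propositional atom
-- whose value is given by the valuation v.
⟦_⟧ : Formula → (Formula → Bool) → Bool
⟦ atom ⊤ₐ ⟧ v = true
⟦ atom ⊥ₐ ⟧ v = false
⟦ atom (var n) ⟧ v = v (atom (var n))
⟦ φ ∧' ψ ⟧ v = ⟦ φ ⟧ v ∧ ⟦ ψ ⟧ v
⟦ ¬' φ ⟧ v = not (⟦ φ ⟧ v)
⟦ □ φ ⟧ v = v (□ φ)
⟦ K φ ⟧ v = v (K φ)

Tautology : Formula → Set
Tautology φ = ∀ (v : Formula → Bool) → ⟦ φ ⟧ v ≡ true

data ⊢_ : Formula → Set where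
  taut   : ∀ {φ} → Tautology φ → ⊢ φ
  ax2    : ∀ (a : Atom) → ⊢ ((atom a ⇒ □ atom a) ∧' (¬' atom a ⇒ □ ¬' atom a))
  ax3    : ∀ φ ψ → ⊢ (□ (φ ⇒ ψ) ⇒ (□ φ ⇒ □ ψ))
  ax4    : ∀ φ → ⊢ (□ φ ⇒ φ)
  ax5    : ∀ φ → ⊢ (□ φ ⇒ □ □ φ)
  ax6    : ∀ φ ψ → ⊢ (K (φ ⇒ ψ) ⇒ (K φ ⇒ K ψ))
  ax7    : ∀ φ → ⊢ (K φ ⇒ φ)
  ax8    : ∀ φ → ⊢ (K φ ⇒ K K φ)
  ax9    : ∀ φ → ⊢ (φ ⇒ K L φ)
  ax10   : ∀ φ → ⊢ (K □ φ ⇒ □ K φ)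
  ax11   : ∀ φ → ⊢ (◇ □ φ ⇒ □ ◇ φ)
  ax12   : ∀ φ ψ χ →
           ⊢ ((◇ (K φ ∧' ψ) ∧' L ◇ (K φ ∧' χ))
               ⇒ ◇ (K ◇ φ ∧' ◇ ψ ∧' L ◇ χ))
  mp     : ∀ {φ ψ} → ⊢ (φ ⇒ ψ) → ⊢ φ → ⊢ ψ
  necK   : ∀ {φ} → ⊢ φ → ⊢ K φ
  nec□   : ∀ {φ} → ⊢ φ → ⊢ □ φ

infix 2 ⊢_

data InL' : Formula → Set where
  atomL : ∀ a → InL' (atom a)
  andL  : ∀ {φ ψ} → InL' φ → InL' ψ → InL' (φ ∧' ψ)
  negL  : ∀ {φ} → InL' φ → InL' (¬' φ)
  dkL   : ∀ {φ} → InL' φ → InL' (◇ K φ)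

BiPersistent : Formula → Set
BiPersistent φ = ⊢ ((φ ⇒ □ φ) ∧' (¬' φ ⇒ □ ¬' φ))

{-# OPTIONS --safe #-}
-- Persistence of ∧ and ¬ is propositional bookkeeping plus the normality of □.
-- For ◇Kφ: persistence of φ lifts through K by K-monotonicity and axiom 10
-- (K□φ → □Kφ), then through ◇ by axiom 11 (◇□ψ → □◇ψ); the negation ¬◇Kφ,
-- being □¬Kφ, is persistent by axiom 5.
module Submission where

open import Defs
open import Data.Bool using (Bool; true; false; _∧_; not; T)
open import Data.Bool.Properties using (T-∧; T-≡)
open import Data.Fin using (Fin; zero; suc)
open import Data.Nat using (ℕ; zero; suc; _+_)
open import Data.Product using (proj₁; proj₂)
open import Data.Vec using (Vec; []; _∷_; lookup; map)
open import Data.Vec.Properties using (lookup-map)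
open import Function using (_∘_)
open import Function.Bundles using (Equivalence)
open import Relation.Binary.PropositionalEquality using (_≡_; sym; trans; cong; cong₂)

private
  variable
    n : ℕ
    φ ψ χ φ′ ψ′ : Formula

data Schema (n : ℕ) : Set where
  pvar : Fin n → Schema n
  _&_  : Schema n → Schema n → Schema n
  ~_   : Schema n → Schema n

infixr 6 _&_
infix 8 ~_
infixr 4 _⟶_

_⟶_ : Schema n → Schema n → Schema n
a ⟶ b = ~ (a & ~ b)

p : Schema (1 + n)
p = pvar zero

q : Schema (2 + n)
q = pvar (suc zero)

r : Schema (3 + n)
r = pvar (suc (suc zero))

s : Schema (4 + n)
s = pvar (suc (suc (suc zero)))

instantiate : Vec Formula n → Schema n → Formula
instantiate σ (pvar i) = lookup σ i
instantiate σ (a & b)  = instantiate σ a ∧' instantiate σ b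
instantiate σ (~ a)    = ¬' instantiate σ a

evaluate : Vec Bool n → Schema n → Bool
evaluate ρ (pvar i) = lookup ρ i
evaluate ρ (a & b)  = evaluate ρ a ∧ evaluate ρ b
evaluate ρ (~ a)    = not (evaluate ρ a)

∀ᵇ : ∀ n → (Vec Bool n → Bool) → Bool
∀ᵇ zero    f = f []
∀ᵇ (suc n) f = ∀ᵇ n (f ∘ (true ∷_)) ∧ ∀ᵇ n (f ∘ (false ∷_))

∀ᵇ-sound : ∀ n (f : Vec Bool n → Bool) → T (∀ᵇ n f) → ∀ ρ → T (f ρ)
∀ᵇ-sound zero    f t [] = t
∀ᵇ-sound (suc n) f t (true ∷ ρ) =
  ∀ᵇ-sound n _ (proj₁ (Equivalence.to (T-∧ {∀ᵇ n (f ∘ (true ∷_))}) t)) ρ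
∀ᵇ-sound (suc n) f t (false ∷ ρ) =
  ∀ᵇ-sound n _ (proj₂ (Equivalence.to (T-∧ {∀ᵇ n (f ∘ (true ∷_))}) t)) ρ

isTautology : Schema n → Bool
isTautology {n} a = ∀ᵇ n (λ ρ → evaluate ρ a)

⟦instantiate⟧ : (σ : Vec Formula n) (a : Schema n) (v : Formula → Bool) →
                ⟦ instantiate σ a ⟧ v ≡ evaluate (map (λ φ → ⟦ φ ⟧ v) σ) a
⟦instantiate⟧ σ (pvar i) v = sym (lookup-map i (λ φ → ⟦ φ ⟧ v) σ)
⟦instantiate⟧ σ (a & b)  v = cong₂ _∧_ (⟦instantiate⟧ σ a v) (⟦instantiate⟧ σ b v)
⟦instantiate⟧ σ (~ a)    v = cong not (⟦instantiate⟧ σ a v)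

tautology : (σ : Vec Formula n) (a : Schema n) {_ : T (isTautology a)} →
            ⊢ instantiate σ a
tautology {n} σ a {t} = taut λ v →
  trans (⟦instantiate⟧ σ a v)
        (Equivalence.to T-≡ (∀ᵇ-sound n (λ ρ → evaluate ρ a) t _))

∧-intro : ⊢ φ → ⊢ ψ → ⊢ φ ∧' ψ
∧-intro {φ} {ψ} ⊢φ ⊢ψ = mp (mp (tautology (φ ∷ ψ ∷ []) (p ⟶ q ⟶ p & q)) ⊢φ) ⊢ψ

∧-proj₁ : ⊢ φ ∧' ψ → ⊢ φ
∧-proj₁ {φ} {ψ} = mp (tautology (φ ∷ ψ ∷ []) (p & q ⟶ p))

∧-proj₂ : ⊢ φ ∧' ψ → ⊢ ψ
∧-proj₂ {φ} {ψ} = mp (tautology (φ ∷ ψ ∷ []) (p & q ⟶ q))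

⇒-trans : ⊢ φ ⇒ ψ → ⊢ ψ ⇒ χ → ⊢ φ ⇒ χ
⇒-trans {φ} {ψ} {χ} φ⇒ψ ψ⇒χ =
  mp (tautology (φ ∷ ψ ∷ χ ∷ []) ((p ⟶ q) & (q ⟶ r) ⟶ (p ⟶ r))) (∧-intro φ⇒ψ ψ⇒χ)

contrapose : ⊢ φ ⇒ ψ → ⊢ ¬' ψ ⇒ ¬' φ
contrapose {φ} {ψ} = mp (tautology (φ ∷ ψ ∷ []) ((p ⟶ q) ⟶ (~ q ⟶ ~ p)))

¬¬-intro : ⊢ φ ⇒ ¬' ¬' φ
¬¬-intro {φ} = tautology (φ ∷ []) (p ⟶ ~ ~ p)

¬¬-elim : ⊢ ¬' ¬' φ ⇒ φ
¬¬-elim {φ} = tautology (φ ∷ []) (~ ~ p ⟶ p)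

∧-map : ⊢ φ ⇒ φ′ → ⊢ ψ ⇒ ψ′ → ⊢ φ ∧' ψ ⇒ φ′ ∧' ψ′
∧-map {φ} {φ′} {ψ} {ψ′} φ⇒φ′ ψ⇒ψ′ =
  mp (tautology (φ ∷ ψ ∷ φ′ ∷ ψ′ ∷ []) ((p ⟶ r) & (q ⟶ s) ⟶ (p & q ⟶ r & s)))
     (∧-intro φ⇒φ′ ψ⇒ψ′)

¬∧-elim : ⊢ ¬' φ ⇒ χ → ⊢ ¬' ψ ⇒ χ → ⊢ ¬' (φ ∧' ψ) ⇒ χ
¬∧-elim {φ} {χ} {ψ} ¬φ⇒χ ¬ψ⇒χ =
  mp (tautology (φ ∷ ψ ∷ χ ∷ []) ((~ p ⟶ r) & (~ q ⟶ r) ⟶ (~ (p & q) ⟶ r)))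
     (∧-intro ¬φ⇒χ ¬ψ⇒χ)

⇒-uncurry : ⊢ φ ⇒ ψ ⇒ χ → ⊢ φ ∧' ψ ⇒ χ
⇒-uncurry {φ} {ψ} {χ} = mp (tautology (φ ∷ ψ ∷ χ ∷ []) ((p ⟶ q ⟶ r) ⟶ (p & q ⟶ r)))

□-mono : ⊢ φ ⇒ ψ → ⊢ □ φ ⇒ □ ψ
□-mono {φ} {ψ} = mp (ax3 φ ψ) ∘ nec□

◇-mono : ⊢ φ ⇒ ψ → ⊢ ◇ φ ⇒ ◇ ψ
◇-mono = contrapose ∘ □-mono ∘ contrapose

K-mono : ⊢ φ ⇒ ψ → ⊢ K φ ⇒ K ψ
K-mono {φ} {ψ} = mp (ax6 φ ψ) ∘ necK

□-∧ : ⊢ □ φ ∧' □ ψ ⇒ □ (φ ∧' ψ)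
□-∧ {φ} {ψ} = ⇒-uncurry (⇒-trans (□-mono (tautology (φ ∷ ψ ∷ []) (p ⟶ q ⟶ p & q)))
                                   (ax3 ψ (φ ∧' ψ)))

Persistent : Formula → Set
Persistent φ = ⊢ φ ⇒ □ φ

biPersistent : Persistent φ → Persistent (¬' φ) → BiPersistent φ
biPersistent = ∧-intro

biPersistent⇒persistent : BiPersistent φ → Persistent φ
biPersistent⇒persistent = ∧-proj₁

biPersistent⇒persistent-¬ : BiPersistent φ → Persistent (¬' φ)
biPersistent⇒persistent-¬ = ∧-proj₂

persistent-¬¬ : Persistent φ → Persistent (¬' ¬' φ)
persistent-¬¬ φ⇒□φ = ⇒-trans ¬¬-elim (⇒-trans φ⇒□φ (□-mono ¬¬-intro))

persistent-∧ : Persistent φ → Persistent ψ → Persistent (φ ∧' ψ)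
persistent-∧ φ⇒□φ ψ⇒□ψ = ⇒-trans (∧-map φ⇒□φ ψ⇒□ψ) □-∧

persistent-¬∧ : Persistent (¬' φ) → Persistent (¬' ψ) → Persistent (¬' (φ ∧' ψ))
persistent-¬∧ {φ} {ψ} ¬φ⇒□¬φ ¬ψ⇒□¬ψ = ¬∧-elim
  (⇒-trans ¬φ⇒□¬φ (□-mono (tautology (φ ∷ ψ ∷ []) (~ p ⟶ ~ (p & q)))))
  (⇒-trans ¬ψ⇒□¬ψ (□-mono (tautology (φ ∷ ψ ∷ []) (~ q ⟶ ~ (p & q)))))

persistent-K : Persistent φ → Persistent (K φ)
persistent-K {φ} φ⇒□φ = ⇒-trans (K-mono φ⇒□φ) (ax10 φ)

persistent-◇ : Persistent φ → Persistent (◇ φ)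
persistent-◇ {φ} φ⇒□φ = ⇒-trans (◇-mono φ⇒□φ) (ax11 φ)

persistent-¬◇ : Persistent (¬' ◇ φ)
persistent-¬◇ {φ} = ⇒-trans ¬¬-elim (⇒-trans (ax5 (¬' φ)) (□-mono ¬¬-intro))

biPersistent-¬ : BiPersistent φ → BiPersistent (¬' φ)
biPersistent-¬ bp =
  biPersistent (biPersistent⇒persistent-¬ bp) (persistent-¬¬ (biPersistent⇒persistent bp))

biPersistent-∧ : BiPersistent φ → BiPersistent ψ → BiPersistent (φ ∧' ψ)
biPersistent-∧ bpφ bpψ = biPersistent
  (persistent-∧ (biPersistent⇒persistent bpφ) (biPersistent⇒persistent bpψ))
  (persistent-¬∧ (biPersistent⇒persistent-¬ bpφ) (biPersistent⇒persistent-¬ bpψ))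

biPersistent-◇ : Persistent φ → BiPersistent (◇ φ)
biPersistent-◇ φ⇒□φ = biPersistent (persistent-◇ φ⇒□φ) persistent-¬◇

mainTheorem10 : ∀ (φ : Formula) → InL' φ → BiPersistent φ
mainTheorem10 _ (atomL a)   = ax2 a
mainTheorem10 _ (andL φ∈ ψ∈) = biPersistent-∧ (mainTheorem10 _ φ∈) (mainTheorem10 _ ψ∈)
mainTheorem10 _ (negL φ∈)    = biPersistent-¬ (mainTheorem10 _ φ∈)
mainTheorem10 _ (dkL φ∈)     =
  biPersistent-◇ (persistent-K (biPersistent⇒persistent (mainTheorem10 _ φ∈)))
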